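{- Let $I$ be an interval of constructive real numbers and let $f$ be a constructive function defined on $I$ (with constructive real input and output) which is potentially locally constant. Then $f$ is constant on $I$: for all $x,y\in I$, $f(x)=f(y)$.
   Context: The setting is constructive mathematics in the sense of the Russian school (Markov), with Markov's principle allowed: if an element of an algorithmically enumerable set cannot fail to exist, then such an element can be found algorithmically. A constructive real number (CRN) is an algorithmically given Cauchy sequence of rationals $\{x_n\}$ together with an algorithm which, given a rational $\epsilon>0$, produces $M$ such that $|x_m-x_n|<\epsilon$ for all $m,n>M$; two CRNs are equal if the terms of their sequences with sufficiently large indices are arbitrarily close. A constructive function is an algorithm transforming CRNs into CRNs such that equal inputs give equal outputs. For a point $x$ of a constructive metric space and a natural number $n$, $B(x,n)$ denotes the open ball of radius $2^{ -n}$ centred at $x$. A constructive map $F$ is potentially locally constant if for every point $x$ it is impossible that there is no natural number $n$ such that all values of $F$ on the points of $B(x,n)$ are equal (i.e. such an $n$ "cannot not exist"; no algorithm producing $n$ is required). -}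

module Defs where

open import Data.Nat using (ℕ; zero; suc)
import Data.Nat as ℕ
open import Data.Rational.Unnormalised
  using (ℚᵘ; 0ℚᵘ; 1ℚᵘ; ½; _+_; _*_; _-_; ∣_∣; _<_; _≤_)
open import Data.Product using (Σ; ∃; _×_; _,_)
open import Relation.Nullary using (¬_)

½^ : ℕ → ℚᵘ
½^ zero    = 1ℚᵘ
½^ (suc n) = ½ * ½^ n

record ℝ : Set where
  constructor mkℝ
  field
    seq    : ℕ → ℚᵘ
    modulus : (ε : ℚᵘ) → 0ℚᵘ < ε → ℕ
    cauchy : (ε : ℚᵘ) (ε>0 : 0ℚᵘ < ε) (m n : ℕ) →
             modulus ε ε>0 ℕ.< m → modulus ε ε>0 ℕ.< n →
             ∣ seq m - seq n ∣ < ε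
open ℝ public

_≃_ : ℝ → ℝ → Set
x ≃ y = (ε : ℚᵘ) → 0ℚᵘ < ε →
        ∃ λ N → (m n : ℕ) → N ℕ.< m → N ℕ.< n → ∣ seq x m - seq y n ∣ < ε

_≤ᵣ_ : ℝ → ℝ → Set
x ≤ᵣ y = (ε : ℚᵘ) → 0ℚᵘ < ε →
         ∃ λ N → (m : ℕ) → N ℕ.< m → seq x m ≤ seq y m + ε

-- z lies in the open ball B(x,n) of radius 2^{-n}: |z - x| < 2^{-n}, i.e.
-- there are a rational δ > 0 and N with |z_m - x_m| ≤ 2^{-n} - δ for m > N.
_∈B[_,_] : ℝ → ℝ → ℕ → Set
z ∈B[ x , n ] = Σ ℚᵘ λ δ → (0ℚᵘ < δ) ×
                ∃ λ N → (m : ℕ) → N ℕ.< m → ∣ seq z m - seq x m ∣ ≤ ½^ n - δ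

IsInterval : (ℝ → Set) → Set
IsInterval I = (x y z : ℝ) → I x → I y → x ≤ᵣ z → z ≤ᵣ y → I z

IsConstructiveFunction : (I : ℝ → Set) → ((x : ℝ) → I x → ℝ) → Set
IsConstructiveFunction I f =
  (x y : ℝ) (hx : I x) (hy : I y) → x ≃ y → f x hx ≃ f y hy

PotentiallyLocallyConstant : (I : ℝ → Set) → ((x : ℝ) → I x → ℝ) → Set
PotentiallyLocallyConstant I f =
  (x : ℝ) → I x →
  ¬ ¬ (∃ λ n → (z w : ℝ) (hz : I z) (hw : I w) →
               z ∈B[ x , n ] → w ∈B[ x , n ] → f z hz ≃ f w hw)

{-# OPTIONS --safe #-}
module Submission where

open import Defs

open import Data.Nat as ℕ using (ℕ; zero; suc; _⊔_)
import Data.Nat.Properties as ℕP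
import Data.Integer as ℤ
import Data.Integer.Properties as ℤP
open import Data.Rational.Unnormalised as ℚ
  using (ℚᵘ; mkℚᵘ; 0ℚᵘ; 1ℚᵘ; ½; _+_; _*_; _-_; -_; ∣_∣; _<_; _≤_; *≡*; *≤*; *<*)
  renaming (_≃_ to _≈_)
import Data.Rational.Unnormalised.Properties as ℚP
open import Data.Rational.Unnormalised.Solver using (module +-*-Solver)
open +-*-Solver using (solve; _:+_; _:*_; _:-_; :-_; _:=_; con)
open import Data.Product using (Σ; ∃; _×_; _,_; proj₁; proj₂)
open import Data.Sum using (_⊎_; inj₁; inj₂)
open import Data.Empty using (⊥; ⊥-elim)
open import Relation.Nullary using (¬_; Dec; yes; no)
open import Relation.Binary.PropositionalEquality using (_≡_; refl; sym; trans; cong; subst)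

-- Equality of constructive reals is ¬¬-stable (it is the negation of apartness), so it
-- suffices to refute f x # f y; no appeal to Markov's principle is needed.  Such an
-- apartness forces x # y, say x < y.  Inside a proof of ⊥ we may use the radii of local
-- constancy at x and y, and these move the apartness to rational points r ≤ s between x
-- and y.  Bisecting [r, s] while keeping, by cotransitivity, a half whose endpoints
-- still have apart values gives nested rational intervals shrinking to a point c of I;
-- on a ball around c on which f is constant both endpoints of a late interval must then
-- have equal values.

-- Rational arithmetic

infixl 6 _⊕_
_⊕_ : ∀ {a b c d} → a ≤ b → c ≤ d → a + c ≤ b + d
_⊕_ = ℚP.+-mono-≤

≤-by-difference : ∀ {S T L R} → S ≤ T → T - S ≈ R - L → L ≤ R
≤-by-difference S≤T eq = ℚP.0≤q-p⇒p≤q (ℚP.≤-respʳ-≃ eq (ℚP.p≤q⇒0≤q-p S≤T))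

<-by-difference : ∀ {S T L R} → S < T → T - S ≈ R - L → L < R
<-by-difference {S} {T} {L} {R} S<T eq =
  ℚP.<-respʳ-≃ L+[R-L]≈R (ℚP.<-respˡ-≃ (ℚP.+-identityʳ L) (ℚP.+-monoʳ-< L 0<R-L))
  where
  0<R-L : 0ℚᵘ < R - L
  0<R-L = ℚP.<-respʳ-≃ eq (ℚP.<-respˡ-≃ (ℚP.+-inverseʳ S) (ℚP.+-monoˡ-< (- S) S<T))
  L+[R-L]≈R : L + (R - L) ≈ R
  L+[R-L]≈R = solve 2 (λ l r → l :+ (r :- l) := r) ℚP.≃-refl L R

p≤∣p∣ : ∀ p → p ≤ ∣ p ∣
p≤∣p∣ (mkℚᵘ (ℤ.+ n)    d) = ℚP.≤-refl
p≤∣p∣ (mkℚᵘ ℤ.-[1+ n ] d) = *≤* ℤ.-≤+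

p≤r∧-p≤r⇒∣p∣≤r : ∀ {p r} → p ≤ r → - p ≤ r → ∣ p ∣ ≤ r
p≤r∧-p≤r⇒∣p∣≤r {mkℚᵘ (ℤ.+ n)    d} p≤r _   = p≤r
p≤r∧-p≤r⇒∣p∣≤r {mkℚᵘ ℤ.-[1+ n ] d} _ -p≤r = -p≤r

∣p-p∣≈0 : ∀ p → ∣ p - p ∣ ≈ 0ℚᵘ
∣p-p∣≈0 p = ℚP.∣-∣-cong (ℚP.+-inverseʳ p)

∣p-q∣<r⇒p<q+r : ∀ p {q r} → ∣ p - q ∣ < r → p < q + r
∣p-q∣<r⇒p<q+r p {q} {r} h = <-by-difference (ℚP.≤-<-trans (p≤∣p∣ (p - q)) h)
  (solve 3 (λ p q r → r :- (p :- q) := q :+ r :- p) ℚP.≃-refl p q r)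

∣p-q∣≈∣q-p∣ : ∀ p q → ∣ p - q ∣ ≈ ∣ q - p ∣
∣p-q∣≈∣q-p∣ p q = ℚP.≃-trans (ℚP.≃-sym (ℚP.∣-p∣≃∣p∣ (p - q)))
  (ℚP.∣-∣-cong (solve 2 (λ p q → :- (p :- q) := q :- p) ℚP.≃-refl p q))

p≤q+r∧q≤p+r⇒∣p-q∣≤r : ∀ {p q r} → p ≤ q + r → q ≤ p + r → ∣ p - q ∣ ≤ r
p≤q+r∧q≤p+r⇒∣p-q∣≤r {p} {q} {r} p≤q+r q≤p+r = p≤r∧-p≤r⇒∣p∣≤r
  (≤-by-difference p≤q+r (solve 3 (λ p q r → q :+ r :- p := r :- (p :- q)) ℚP.≃-refl p q r))
  (≤-by-difference q≤p+r (solve 3 (λ p q r → p :+ r :- q := r :- (:- (p :- q))) ℚP.≃-refl p q r))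

r≤∣p-q∣⇒q+r≤p⊎p+r≤q : ∀ {p q r} → r ≤ ∣ p - q ∣ → q + r ≤ p ⊎ p + r ≤ q
r≤∣p-q∣⇒q+r≤p⊎p+r≤q {p} {q} {r} r≤∣p-q∣ with ℚP.∣p∣≡p∨∣p∣≡-p (p - q)
... | inj₁ ∣p-q∣≡p-q = inj₁ (≤-by-difference (subst (r ≤_) ∣p-q∣≡p-q r≤∣p-q∣)
  (solve 3 (λ p q r → p :- q :- r := p :- (q :+ r)) ℚP.≃-refl p q r))
... | inj₂ ∣p-q∣≡q-p = inj₂ (≤-by-difference (subst (r ≤_) ∣p-q∣≡q-p r≤∣p-q∣)
  (solve 3 (λ p q r → :- (p :- q) :- r := q :- (p :+ r)) ℚP.≃-refl p q r))

∣p+u-q∣≤∣p-q∣+∣u∣ : ∀ p u q → ∣ p + u - q ∣ ≤ ∣ p - q ∣ + ∣ u ∣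
∣p+u-q∣≤∣p-q∣+∣u∣ p u q = ℚP.≤-respˡ-≃
  (ℚP.∣-∣-cong (solve 3 (λ p u q → p :- q :+ u := p :+ u :- q) ℚP.≃-refl p u q))
  (ℚP.∣p+q∣≤∣p∣+∣q∣ (p - q) u)

½^-pos : ∀ k → 0ℚᵘ < ½^ k
½^-pos zero    = *<* (ℤ.+<+ (ℕ.s≤s ℕ.z≤n))
½^-pos (suc k) = ℚP.<-respˡ-≃ (ℚP.*-zeroʳ ½) (ℚP.*-monoʳ-<-pos ½ (½^-pos k))

½^-nonNeg : ∀ k → ℚ.NonNegative (½^ k)
½^-nonNeg k = ℚ.nonNegative (ℚP.<⇒≤ (½^-pos k))

½^-halves : ∀ k → ½^ (suc k) + ½^ (suc k) ≈ ½^ k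
½^-halves k = ℚP.≃-trans
  (solve 2 (λ h u → h :* u :+ h :* u := (h :+ h) :* u) ℚP.≃-refl ½ (½^ k))
  (ℚP.≃-trans (ℚP.*-congʳ {½^ k} {½ + ½} {1ℚᵘ} (*≡* refl)) (ℚP.*-identityˡ (½^ k)))

½^-antitone : ∀ {k m} → k ℕ.≤ m → ½^ m ≤ ½^ k
½^-antitone k≤m = go (ℕP.≤⇒≤′ k≤m)
  where
  ½^[1+k]≤½^k : ∀ k → ½^ (suc k) ≤ ½^ k
  ½^[1+k]≤½^k k = ℚP.≤-trans (ℚP.p≤p+q (½^ (suc k)) (½^ (suc k)) {{½^-nonNeg (suc k)}})
                             (ℚP.≤-reflexive (½^-halves k))
  go : ∀ {k m} → k ℕ.≤′ m → ½^ m ≤ ½^ k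
  go ℕ.≤′-refl                    = ℚP.≤-refl
  go {m = suc m} (ℕ.≤′-step k≤′m) = ℚP.≤-trans (½^[1+k]≤½^k m) (go k≤′m)

½^≤1/[1+k] : ∀ k → ½^ k ≤ mkℚᵘ (ℤ.+ 1) k
½^≤1/[1+k] zero    = ℚP.≤-refl
½^≤1/[1+k] (suc k) = ℚP.≤-trans (ℚP.*-monoʳ-≤-nonNeg ½ (½^≤1/[1+k] k))
  (*≤* (ℤ.+≤+ (ℕ.s≤s (ℕP.m≤n⇒m≤n+o 0 (ℕP.m≤n+m _ k)))))

½^-small : ∀ {ε} → 0ℚᵘ < ε → ∃ λ k → ½^ k < ε
½^-small {mkℚᵘ (ℤ.+ zero)  d} (*<* (ℤ.+<+ ()))
½^-small {mkℚᵘ ℤ.-[1+ n ]  d} (*<* ())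
½^-small {mkℚᵘ (ℤ.+ suc n) d} _ = suc d ,
  ℚP.≤-<-trans (½^≤1/[1+k] (suc d)) (ℚP.<-≤-trans 1/[2+d]<1/[1+d] 1/[1+d]≤[1+n]/[1+d])
  where
  1/[2+d]<1/[1+d] : mkℚᵘ (ℤ.+ 1) (suc d) < mkℚᵘ (ℤ.+ 1) d
  1/[2+d]<1/[1+d] = *<* (ℤ.+<+ ℕP.≤-refl)
  1/[1+d]≤[1+n]/[1+d] : mkℚᵘ (ℤ.+ 1) d ≤ mkℚᵘ (ℤ.+ suc n) d
  1/[1+d]≤[1+n]/[1+d] = *≤* (ℤ.+≤+ (ℕP.*-monoˡ-≤ (suc d) {1} {suc n} (ℕ.s≤s ℕ.z≤n)))

toℚᵘ : ℕ → ℚᵘ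
toℚᵘ zero    = 0ℚᵘ
toℚᵘ (suc n) = 1ℚᵘ + toℚᵘ n

toℚᵘ-≈ : ∀ n → toℚᵘ n ≈ mkℚᵘ (ℤ.+ n) 0
toℚᵘ-≈ zero    = ℚP.≃-refl
toℚᵘ-≈ (suc n) = ℚP.≃-trans (ℚP.+-congʳ 1ℚᵘ (toℚᵘ-≈ n)) (*≡* (trans (ℤP.*-identityʳ _)
  (trans (cong (ℤ._+_ ℤ.1ℤ) (ℤP.*-identityʳ (ℤ.+ n))) (sym (ℤP.*-identityʳ _)))))

≤toℚᵘ : ∀ q → ∃ λ N → q ≤ toℚᵘ N
≤toℚᵘ (mkℚᵘ z d) =
  ℤ.∣ z ∣ , ℚP.≤-respʳ-≃ (ℚP.≃-sym (toℚᵘ-≈ ℤ.∣ z ∣)) (*≤* (z≤∣z∣*[1+d] z))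
  where
  z≤∣z∣*[1+d] : ∀ z → z ℤ.* ℤ.+ 1 ℤ.≤ ℤ.+ ℤ.∣ z ∣ ℤ.* ℤ.+ (suc d)
  z≤∣z∣*[1+d] (ℤ.+ n) rewrite ℤP.*-identityʳ (ℤ.+ n) | sym (ℤP.pos-* n (suc d)) =
    ℤ.+≤+ (ℕP.m≤m*n n (suc d))
  z≤∣z∣*[1+d] ℤ.-[1+ n ] rewrite ℤP.*-identityʳ ℤ.-[1+ n ] = ℤ.-≤+

toℚᵘ*½^≤½^ : ∀ N k → toℚᵘ N * ½^ (N ℕ.+ k) ≤ ½^ k
toℚᵘ*½^≤½^ zero    k = ℚP.≤-respˡ-≃ (ℚP.≃-sym (ℚP.*-zeroˡ (½^ k))) (ℚP.<⇒≤ (½^-pos k))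
toℚᵘ*½^≤½^ (suc N) k = ℚP.≤-respʳ-≃ ½*[½^k+½^k]≈½^k (ℚP.≤-respˡ-≃ regroup
  (ℚP.*-monoʳ-≤-nonNeg ½ (toℚᵘ*½^≤½^ N k ⊕ ½^-antitone (ℕP.m≤n+m k N))))
  where
  v = ½^ (N ℕ.+ k)
  ½*[½^k+½^k]≈½^k : ½ * (½^ k + ½^ k) ≈ ½^ k
  ½*[½^k+½^k]≈½^k = ℚP.≃-trans (ℚP.*-distribˡ-+ ½ (½^ k) (½^ k)) (½^-halves k)
  regroup : ½ * (toℚᵘ N * v + v) ≈ (1ℚᵘ + toℚᵘ N) * (½ * v)
  regroup = solve 3 (λ h n v → h :* (n :* v :+ v) := (con 1ℚᵘ :+ n) :* (h :* v))
                    ℚP.≃-refl ½ (toℚᵘ N) v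

*½^-small : ∀ q {ε} → 0ℚᵘ < ε → ∃ λ k → q * ½^ k < ε
*½^-small q ε>0 with ≤toℚᵘ q | ½^-small ε>0
... | N , q≤N | k , ½^k<ε = N ℕ.+ k , ℚP.≤-<-trans
  (ℚP.≤-trans (ℚP.*-monoˡ-≤-nonNeg (½^ (N ℕ.+ k)) {{½^-nonNeg (N ℕ.+ k)}} q≤N)
              (toℚᵘ*½^≤½^ N k))
  ½^k<ε

-- Order and apartness of constructive reals

cauchyIndex : ℝ → ℕ → ℕ
cauchyIndex a k = modulus a (½^ k) (½^-pos k)

cauchy-½^ : ∀ a k {m n} → cauchyIndex a k ℕ.< m → cauchyIndex a k ℕ.< n →
            ∣ seq a m - seq a n ∣ < ½^ k
cauchy-½^ a k = cauchy a (½^ k) (½^-pos k) _ _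

≃-sym : ∀ {a b} → a ≃ b → b ≃ a
≃-sym {a} {b} a≃b ε ε>0 with a≃b ε ε>0
... | N , close = N , λ m n m> n> →
  ℚP.<-respˡ-≃ (∣p-q∣≈∣q-p∣ (seq a n) (seq b m)) (close n m n> m>)

infix 4 _<ᵣ_ _#_

record _<ᵣ_ (a b : ℝ) : Set where
  constructor mk<ᵣ
  field
    gapExponent : ℕ
    gapIndex    : ℕ
    gap         : ∀ m → gapIndex ℕ.< m → seq a m + ½^ gapExponent ≤ seq b m

_#_ : ℝ → ℝ → Set
a # b = a <ᵣ b ⊎ b <ᵣ a

#-sym : ∀ {a b} → a # b → b # a
#-sym (inj₁ a<b) = inj₂ a<b
#-sym (inj₂ b<a) = inj₁ b<a

<ᵣ-from-gap : ∀ a b k {m n} → cauchyIndex a (2 ℕ.+ k) ℕ.< m → cauchyIndex b (2 ℕ.+ k) ℕ.< n →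
              seq a m + ½^ k ≤ seq b n → a <ᵣ b
<ᵣ-from-gap a b k {m} {n} m>A n>B am+u≤bn = mk<ᵣ (suc k) (A ⊔ B) λ p p>A⊔B →
  let p>A = ℕP.m⊔n<o⇒m<o A B p>A⊔B
      p>B = ℕP.m⊔n<o⇒n<o A B p>A⊔B
      ap≤am+q = ℚP.<⇒≤ (∣p-q∣<r⇒p<q+r (seq a p) (cauchy-½^ a (2 ℕ.+ k) p>A m>A))
      bn≤bp+q = ℚP.<⇒≤ (∣p-q∣<r⇒p<q+r (seq b n) (cauchy-½^ b (2 ℕ.+ k) n>B p>B))
  in ≤-by-difference
       (ap≤am+q ⊕ bn≤bp+q ⊕ am+u≤bn
          ⊕ ℚP.≤-reflexive (½^-halves (suc k)) ⊕ ℚP.≤-reflexive (½^-halves k))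
       (solve 7 (λ ap am bp bn q h u →
          (am :+ q :+ (bp :+ q) :+ bn :+ h :+ u) :- (ap :+ bn :+ (am :+ u) :+ (q :+ q) :+ (h :+ h))
          := bp :- (ap :+ h))
        ℚP.≃-refl (seq a p) (seq a m) (seq b p) (seq b n) (½^ (2 ℕ.+ k)) (½^ (suc k)) (½^ k))
  where
  A = cauchyIndex a (2 ℕ.+ k)
  B = cauchyIndex b (2 ℕ.+ k)

<ᵣ-cotrans : ∀ {a b} → a <ᵣ b → ∀ c → a <ᵣ c ⊎ c <ᵣ b
<ᵣ-cotrans {a} {b} (mk<ᵣ k K gap) c = compare (seq a m + ½^ (suc k) ℚP.≤? seq c m)
  where
  A = cauchyIndex a (3 ℕ.+ k)
  B = cauchyIndex b (3 ℕ.+ k)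
  C = cauchyIndex c (3 ℕ.+ k)
  m = suc (K ⊔ (A ⊔ (B ⊔ C)))
  K<m : K ℕ.< m
  K<m = ℕ.s≤s (ℕP.m≤m⊔n K _)
  A<m : A ℕ.< m
  A<m = ℕ.s≤s (ℕP.≤-trans (ℕP.m≤m⊔n A _) (ℕP.m≤n⊔m K _))
  B<m : B ℕ.< m
  B<m = ℕ.s≤s (ℕP.≤-trans (ℕP.m≤m⊔n B C) (ℕP.≤-trans (ℕP.m≤n⊔m A _) (ℕP.m≤n⊔m K _)))
  C<m : C ℕ.< m
  C<m = ℕ.s≤s (ℕP.≤-trans (ℕP.m≤n⊔m B C) (ℕP.≤-trans (ℕP.m≤n⊔m A _) (ℕP.m≤n⊔m K _)))
  compare : Dec (seq a m + ½^ (suc k) ≤ seq c m) → a <ᵣ c ⊎ c <ᵣ b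
  compare (yes am+h≤cm) = inj₁ (<ᵣ-from-gap a c (suc k) A<m C<m am+h≤cm)
  compare (no  am+h≰cm) = inj₂ (<ᵣ-from-gap c b (suc k) C<m B<m cm+h≤bm)
    where
    cm+h≤bm : seq c m + ½^ (suc k) ≤ seq b m
    cm+h≤bm = ≤-by-difference
      (ℚP.<⇒≤ (ℚP.≰⇒> am+h≰cm) ⊕ gap m K<m ⊕ ℚP.≤-reflexive (½^-halves k))
      (solve 5 (λ am bm cm h u →
          (am :+ h :+ bm :+ u) :- (cm :+ (am :+ u) :+ (h :+ h)) := bm :- (cm :+ h))
        ℚP.≃-refl (seq a m) (seq b m) (seq c m) (½^ (suc k)) (½^ k))

<ᵣ⇒≄ : ∀ {a b} → a <ᵣ b → ¬ a ≃ b
<ᵣ⇒≄ {a} {b} (mk<ᵣ k K gap) a≃b with ≃-sym {a} {b} a≃b (½^ k) (½^-pos k)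
... | N , close =
  ℚP.<-irrefl ℚP.≃-refl (ℚP.≤-<-trans (gap p K<p) (∣p-q∣<r⇒p<q+r (seq b p) (close p p N<p N<p)))
  where
  p = suc (K ⊔ N)
  K<p : K ℕ.< p
  K<p = ℕ.s≤s (ℕP.m≤m⊔n K N)
  N<p : N ℕ.< p
  N<p = ℕ.s≤s (ℕP.m≤n⊔m K N)

#⇒≄ : ∀ {a b} → a # b → ¬ a ≃ b
#⇒≄         (inj₁ a<b) a≃b = <ᵣ⇒≄ a<b a≃b
#⇒≄ {a} {b} (inj₂ b<a) a≃b = <ᵣ⇒≄ b<a (≃-sym {a} {b} a≃b)

¬#⇒≃ : ∀ {a b} → ¬ a # b → a ≃ b
¬#⇒≃ {a} {b} ¬a#b ε ε>0 with ½^-small ε>0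
... | k , ½^k<ε = A ⊔ B , λ m n m> n> → close m n (ℕP.m⊔n<o⇒m<o A B m>) (ℕP.m⊔n<o⇒n<o A B n>)
  where
  A = cauchyIndex a (2 ℕ.+ k)
  B = cauchyIndex b (2 ℕ.+ k)
  close : ∀ m n → A ℕ.< m → B ℕ.< n → ∣ seq a m - seq b n ∣ < ε
  close m n m>A n>B with ½^ k ℚP.≤? ∣ seq a m - seq b n ∣
  ... | no  small = ℚP.<-trans (ℚP.≰⇒> small) ½^k<ε
  ... | yes large with r≤∣p-q∣⇒q+r≤p⊎p+r≤q large
  ...   | inj₁ bn+u≤am = ⊥-elim (¬a#b (inj₂ (<ᵣ-from-gap b a k n>B m>A bn+u≤am)))
  ...   | inj₂ am+u≤bn = ⊥-elim (¬a#b (inj₁ (<ᵣ-from-gap a b k m>A n>B am+u≤bn)))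

<ᵣ-respˡ-≃ : ∀ {a a′ b} → a <ᵣ b → a ≃ a′ → a′ <ᵣ b
<ᵣ-respˡ-≃ {a′ = a′} a<b a≃a′ with <ᵣ-cotrans a<b a′
... | inj₁ a<a′ = ⊥-elim (<ᵣ⇒≄ a<a′ a≃a′)
... | inj₂ a′<b = a′<b

<ᵣ-respʳ-≃ : ∀ {a b b′} → a <ᵣ b → b ≃ b′ → a <ᵣ b′
<ᵣ-respʳ-≃ {b′ = b′} a<b b≃b′ with <ᵣ-cotrans a<b b′
... | inj₁ a<b′ = a<b′
... | inj₂ b′<b = ⊥-elim (#⇒≄ (inj₂ b′<b) b≃b′)

#-resp-≃ : ∀ {a a′ b b′} → a # b → a ≃ a′ → b ≃ b′ → a′ # b′
#-resp-≃ (inj₁ a<b) a≃a′ b≃b′ = inj₁ (<ᵣ-respʳ-≃ (<ᵣ-respˡ-≃ a<b a≃a′) b≃b′)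
#-resp-≃ (inj₂ b<a) a≃a′ b≃b′ = inj₂ (<ᵣ-respʳ-≃ (<ᵣ-respˡ-≃ b<a b≃b′) a≃a′)

#-cotrans : ∀ {a b} → a # b → ∀ c → a # c ⊎ c # b
#-cotrans (inj₁ a<b) c with <ᵣ-cotrans a<b c
... | inj₁ a<c = inj₁ (inj₁ a<c)
... | inj₂ c<b = inj₂ (inj₁ c<b)
#-cotrans (inj₂ b<a) c with <ᵣ-cotrans b<a c
... | inj₁ b<c = inj₂ (inj₂ b<c)
... | inj₂ c<a = inj₁ (inj₂ c<a)

-- Rational points, intervals and balls

fromℚᵘ : ℚᵘ → ℝ
fromℚᵘ q = mkℝ (λ _ → q) (λ _ _ → 0) λ _ ε>0 _ _ _ _ →
  ℚP.<-respˡ-≃ (ℚP.≃-sym (∣p-p∣≈0 q)) ε>0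

≤ᵣ-intro : ∀ {a b} K → (∀ m → K ℕ.< m → seq a m ≤ seq b m) → a ≤ᵣ b
≤ᵣ-intro K a≤b ε ε>0 = K , λ m m> →
  ℚP.≤-trans (a≤b m m>) (ℚP.p≤p+q _ ε {{ℚ.nonNegative (ℚP.<⇒≤ ε>0)}})

∈-interval : ∀ {I} → IsInterval I → ∀ {x y z} → I x → I y → ∀ K →
             (∀ m → K ℕ.< m → seq x m ≤ seq z m) → (∀ m → K ℕ.< m → seq z m ≤ seq y m) → I z
∈-interval isI {x} {y} {z} hx hy K x≤z z≤y =
  isI x y z hx hy (≤ᵣ-intro {x} {z} K x≤z) (≤ᵣ-intro {z} {y} K z≤y)

∈B-intro : ∀ z x n K → (∀ m → K ℕ.< m → ∣ seq z m - seq x m ∣ ≤ ½^ (suc n)) → z ∈B[ x , n ]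
∈B-intro z x n K close = ½^ (suc n) , ½^-pos (suc n) , K , λ m m> →
  ℚP.≤-trans (close m m>) (≤-by-difference (ℚP.≤-reflexive (½^-halves n))
    (solve 2 (λ h u → u :- (h :+ h) := u :- h :- h) ℚP.≃-refl (½^ (suc n)) (½^ n)))

∈B-centre : ∀ x n → x ∈B[ x , n ]
∈B-centre x n = ∈B-intro x x n 0 λ m _ →
  ℚP.≤-respˡ-≃ (ℚP.≃-sym (∣p-p∣≈0 (seq x m))) (ℚP.<⇒≤ (½^-pos (suc n)))

shifted-term∈B : ∀ a n K {u t} → (∀ m → K ℕ.< m → ∣ seq a K - seq a m ∣ < t) →
                 ∣ u ∣ ≤ t → t + t ≤ ½^ (suc n) → fromℚᵘ (seq a K + u) ∈B[ a , n ]
shifted-term∈B a n K {u} close ∣u∣≤t t+t≤½^[1+n] =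
  ∈B-intro (fromℚᵘ (seq a K + u)) a n K λ m m> →
    ℚP.≤-trans (∣p+u-q∣≤∣p-q∣+∣u∣ (seq a K) u (seq a m))
               (ℚP.≤-trans (ℚP.<⇒≤ (close m m>) ⊕ ∣u∣≤t) t+t≤½^[1+n])

record RationalsBetween (x y : ℝ) (nx ny : ℕ) : Set where
  field
    r s : ℚᵘ
    K   : ℕ
    r≤s : r ≤ s
    x≤r : ∀ m → K ℕ.< m → seq x m ≤ r
    s≤y : ∀ m → K ℕ.< m → s ≤ seq y m
    r∈B : fromℚᵘ r ∈B[ x , nx ]
    s∈B : fromℚᵘ s ∈B[ y , ny ]

-- r and s are late terms of x and y moved inward by a t small against the gap and both radii.
rationalsBetween : ∀ {x y} → x <ᵣ y → ∀ nx ny → RationalsBetween x y nx ny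
rationalsBetween {x} {y} (mk<ᵣ g K₀ gap) nx ny = record
  { r   = seq x K + t
  ; s   = seq y K - t
  ; K   = K
  ; r≤s = ≤-by-difference (gap K K₀<K ⊕ t+t≤½^ (ℕP.m≤n⇒m≤1+n (ℕP.m≤m⊔n g _)))
            (solve 4 (λ xK yK u t → yK :+ u :- (xK :+ u :+ (t :+ t)) := yK :- t :- (xK :+ t))
              ℚP.≃-refl (seq x K) (seq y K) (½^ g) t)
  ; x≤r = λ m m> → ℚP.<⇒≤ (∣p-q∣<r⇒p<q+r (seq x m) (cauchy-½^ x j (ℕP.<-trans X<K m>) X<K))
  ; s≤y = λ m m> → ≤-by-difference (ℚP.<⇒≤ (∣p-q∣<r⇒p<q+r (seq y K) (y-close m m>)))
            (solve 3 (λ yK ym t → ym :+ t :- yK := ym :- (yK :- t)) ℚP.≃-refl (seq y K) (seq y m) t)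
  ; r∈B = shifted-term∈B x nx K x-close (ℚP.≤-reflexive-≡ ∣t∣≡t)
            (t+t≤½^ (ℕ.s≤s (ℕP.≤-trans (ℕP.m≤m⊔n nx ny) (ℕP.m≤n⊔m g _))))
  ; s∈B = shifted-term∈B y ny K y-close (ℚP.≤-reflexive-≡ (trans (ℚP.∣-p∣≡∣p∣ t) ∣t∣≡t))
            (t+t≤½^ (ℕ.s≤s (ℕP.≤-trans (ℕP.m≤n⊔m nx ny) (ℕP.m≤n⊔m g _))))
  }
  where
  G = g ⊔ (nx ⊔ ny)
  j = 2 ℕ.+ G
  t = ½^ j
  K = suc (K₀ ⊔ (cauchyIndex x j ⊔ cauchyIndex y j))
  K₀<K : K₀ ℕ.< K
  K₀<K = ℕ.s≤s (ℕP.m≤m⊔n K₀ _)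
  X<K : cauchyIndex x j ℕ.< K
  X<K = ℕ.s≤s (ℕP.≤-trans (ℕP.m≤m⊔n _ _) (ℕP.m≤n⊔m K₀ _))
  Y<K : cauchyIndex y j ℕ.< K
  Y<K = ℕ.s≤s (ℕP.≤-trans (ℕP.m≤n⊔m _ _) (ℕP.m≤n⊔m K₀ _))
  x-close : ∀ m → K ℕ.< m → ∣ seq x K - seq x m ∣ < t
  x-close m m> = cauchy-½^ x j X<K (ℕP.<-trans X<K m>)
  y-close : ∀ m → K ℕ.< m → ∣ seq y K - seq y m ∣ < t
  y-close m m> = cauchy-½^ y j Y<K (ℕP.<-trans Y<K m>)
  ∣t∣≡t : ∣ t ∣ ≡ t
  ∣t∣≡t = ℚP.0≤p⇒∣p∣≡p (ℚP.<⇒≤ (½^-pos j))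
  t+t≤½^ : ∀ {i} → i ℕ.≤ suc G → t + t ≤ ½^ i
  t+t≤½^ i≤1+G = ℚP.≤-trans (ℚP.≤-reflexive (½^-halves (suc G))) (½^-antitone i≤1+G)

-- Potentially locally constant functions on an interval

module _ {I : ℝ → Set} (isI : IsInterval I) {f : (x : ℝ) → I x → ℝ}
         (plc : PotentiallyLocallyConstant I f) where

  ConstantOnBall : ℝ → ℕ → Set
  ConstantOnBall x n = (z w : ℝ) (hz : I z) (hw : I w) →
                       z ∈B[ x , n ] → w ∈B[ x , n ] → f z hz ≃ f w hw

  module Bisection {r s : ℚᵘ} (r≤s : r ≤ s) (hr : I (fromℚᵘ r)) (hs : I (fromℚᵘ s))
                   (apart : f (fromℚᵘ r) hr # f (fromℚᵘ s) hs) where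

    D : ℚᵘ
    D = s - r

    D*½^-nonNeg : ∀ k → ℚ.NonNegative (D * ½^ k)
    D*½^-nonNeg k =
      ℚP.nonNeg*nonNeg⇒nonNeg D {{ℚ.nonNegative (ℚP.p≤q⇒0≤q-p r≤s)}} (½^ k) {{½^-nonNeg k}}

    record Stage (k : ℕ) : Set where
      field
        lo hi        : ℚᵘ
        r≤lo         : r ≤ lo
        hi≤s         : hi ≤ s
        width        : hi ≈ lo + D * ½^ k
        lo∈I         : I (fromℚᵘ lo)
        hi∈I         : I (fromℚᵘ hi)
        values-apart : f (fromℚᵘ lo) lo∈I # f (fromℚᵘ hi) hi∈I
    open Stage

    Within : ∀ {k} → Stage k → ℚᵘ → Set
    Within st q = lo st ≤ q × q ≤ hi st

    _⊑_ : ∀ {k m} → Stage m → Stage k → Set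
    st′ ⊑ st = lo st ≤ lo st′ × hi st′ ≤ hi st

    ⊑-trans : ∀ {i j k} {st₁ : Stage i} {st₂ : Stage j} {st₃ : Stage k} →
              st₃ ⊑ st₂ → st₂ ⊑ st₁ → st₃ ⊑ st₁
    ⊑-trans (lo₂≤lo₃ , hi₃≤hi₂) (lo₁≤lo₂ , hi₂≤hi₁) =
      ℚP.≤-trans lo₁≤lo₂ lo₂≤lo₃ , ℚP.≤-trans hi₃≤hi₂ hi₂≤hi₁

    lo≤hi : ∀ {k} (st : Stage k) → lo st ≤ hi st
    lo≤hi {k} st = ℚP.≤-respʳ-≃ (ℚP.≃-sym (width st)) (ℚP.p≤p+q (lo st) _ {{D*½^-nonNeg k}})

    ∣-∣≤width : ∀ {k} (st : Stage k) {u v} → Within st u → Within st v → ∣ u - v ∣ ≤ D * ½^ k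
    ∣-∣≤width {k} st (lo≤u , u≤hi) (lo≤v , v≤hi) =
      p≤q+r∧q≤p+r⇒∣p-q∣≤r (below u≤hi lo≤v) (below v≤hi lo≤u)
      where
      below : ∀ {p q} → p ≤ hi st → lo st ≤ q → p ≤ q + D * ½^ k
      below p≤hi lo≤q = ℚP.≤-trans p≤hi
        (ℚP.≤-trans (ℚP.≤-reflexive (width st)) (ℚP.+-monoˡ-≤ (D * ½^ k) lo≤q))

    halve : ∀ {k} (st : Stage k) → Σ (Stage (suc k)) (_⊑ st)
    halve {k} st = choose (#-cotrans (values-apart st) (f (fromℚᵘ c) c∈I))
      where
      d = D * ½^ (suc k)
      c = lo st + d
      D*½^k≈d+d : D * ½^ k ≈ d + d
      D*½^k≈d+d = ℚP.≃-trans (ℚP.*-congˡ {D} (ℚP.≃-sym (½^-halves k))) (ℚP.*-distribˡ-+ D _ _)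
      hi≈c+d : hi st ≈ c + d
      hi≈c+d = ℚP.≃-trans (width st)
        (ℚP.≃-trans (ℚP.+-congʳ (lo st) D*½^k≈d+d) (ℚP.≃-sym (ℚP.+-assoc (lo st) d d)))
      lo≤c : lo st ≤ c
      lo≤c = ℚP.p≤p+q (lo st) d {{D*½^-nonNeg (suc k)}}
      c≤hi : c ≤ hi st
      c≤hi = ℚP.≤-respʳ-≃ (ℚP.≃-sym hi≈c+d) (ℚP.p≤p+q c d {{D*½^-nonNeg (suc k)}})
      c∈I : I (fromℚᵘ c)
      c∈I = ∈-interval isI hr hs 0 (λ _ _ → ℚP.≤-trans (r≤lo st) lo≤c)
                                   (λ _ _ → ℚP.≤-trans c≤hi (hi≤s st))
      fc = f (fromℚᵘ c) c∈I
      choose : f (fromℚᵘ (lo st)) (lo∈I st) # fc ⊎ fc # f (fromℚᵘ (hi st)) (hi∈I st) →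
               Σ (Stage (suc k)) (_⊑ st)
      choose (inj₁ left) =
        record { lo = lo st ; hi = c ; r≤lo = r≤lo st ; hi≤s = ℚP.≤-trans c≤hi (hi≤s st)
               ; width = ℚP.≃-refl ; lo∈I = lo∈I st ; hi∈I = c∈I ; values-apart = left }
        , ℚP.≤-refl , c≤hi
      choose (inj₂ right) =
        record { lo = c ; hi = hi st ; r≤lo = ℚP.≤-trans (r≤lo st) lo≤c ; hi≤s = hi≤s st
               ; width = hi≈c+d ; lo∈I = c∈I ; hi∈I = hi∈I st ; values-apart = right }
        , lo≤c , ℚP.≤-refl

    stage : ∀ k → Stage k
    stage zero    = record
      { lo = r ; hi = s ; r≤lo = ℚP.≤-refl ; hi≤s = ℚP.≤-refl
      ; width = solve 2 (λ r s → s := r :+ (s :- r) :* con 1ℚᵘ) ℚP.≃-refl r s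
      ; lo∈I = hr ; hi∈I = hs ; values-apart = apart }
    stage (suc k) = proj₁ (halve (stage k))

    stage-nested : ∀ {k m} → k ℕ.≤ m → stage m ⊑ stage k
    stage-nested k≤m = go (ℕP.≤⇒≤′ k≤m)
      where
      go : ∀ {k m} → k ℕ.≤′ m → stage m ⊑ stage k
      go ℕ.≤′-refl                    = ℚP.≤-refl , ℚP.≤-refl
      go {k} {suc m} (ℕ.≤′-step k≤′m) =
        ⊑-trans {st₁ = stage k} {stage m} {stage (suc m)} (proj₂ (halve (stage m))) (go k≤′m)

    later-lo-within : ∀ {k m} → k ℕ.≤ m → Within (stage k) (lo (stage m))
    later-lo-within {k} {m} k≤m =
      proj₁ (stage-nested k≤m) , ℚP.≤-trans (lo≤hi (stage m)) (proj₂ (stage-nested k≤m))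

    limit : ℝ
    limit = mkℝ (λ m → lo (stage m)) (λ _ ε>0 → proj₁ (*½^-small D ε>0)) λ _ ε>0 m n m> n> →
      let k = proj₁ (*½^-small D ε>0) in
      ℚP.≤-<-trans
        (∣-∣≤width (stage k) (later-lo-within {k} (ℕP.<⇒≤ m>)) (later-lo-within {k} (ℕP.<⇒≤ n>)))
        (proj₂ (*½^-small D ε>0))

    limit∈I : I limit
    limit∈I = ∈-interval isI hr hs 0 (λ m _ → r≤lo (stage m))
                                     (λ m _ → ℚP.≤-trans (lo≤hi (stage m)) (hi≤s (stage m)))

    ¬ConstantOnBall-limit : ∀ n → ¬ ConstantOnBall limit n
    ¬ConstantOnBall-limit n constant = #⇒≄ (values-apart st) (constant _ _ (lo∈I st) (hi∈I st)
      (near (ℚP.≤-refl , lo≤hi st)) (near (lo≤hi st , ℚP.≤-refl)))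
      where
      k  = proj₁ (*½^-small D (½^-pos (suc n)))
      st = stage k
      near : ∀ {q} → Within st q → fromℚᵘ q ∈B[ limit , n ]
      near {q} q∈st = ∈B-intro (fromℚᵘ q) limit n k λ m k<m →
        ℚP.≤-trans (∣-∣≤width st q∈st (later-lo-within (ℕP.<⇒≤ k<m)))
                   (ℚP.<⇒≤ (proj₂ (*½^-small D (½^-pos (suc n)))))

    absurd : ⊥
    absurd = plc limit limit∈I λ (n , constant) → ¬ConstantOnBall-limit n constant

  values-not-apart-at-rationals : ∀ {r s} → r ≤ s → (hr : I (fromℚᵘ r)) (hs : I (fromℚᵘ s)) →
                                  ¬ f (fromℚᵘ r) hr # f (fromℚᵘ s) hs
  values-not-apart-at-rationals r≤s hr hs apart = Bisection.absurd r≤s hr hs apart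

  values-not-apart-at-<ᵣ : ∀ {x y} (hx : I x) (hy : I y) → x <ᵣ y → ¬ f x hx # f y hy
  values-not-apart-at-<ᵣ {x} {y} hx hy x<y apart =
    plc x hx λ (nx , constant-x) → plc y hy λ (ny , constant-y) →
      let open RationalsBetween (rationalsBetween x<y nx ny)
          hr = ∈-interval isI hx hy K x≤r (λ m m> → ℚP.≤-trans r≤s (s≤y m m>))
          hs = ∈-interval isI hx hy K (λ m m> → ℚP.≤-trans (x≤r m m>) r≤s) s≤y
      in values-not-apart-at-rationals r≤s hr hs (#-resp-≃ apart
           (constant-x x (fromℚᵘ r) hx hr (∈B-centre x nx) r∈B)
           (constant-y y (fromℚᵘ s) hy hs (∈B-centre y ny) s∈B))

  values-not-apart-at-# : ∀ {x y} (hx : I x) (hy : I y) → x # y → ¬ f x hx # f y hy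
  values-not-apart-at-# hx hy (inj₁ x<y) apart = values-not-apart-at-<ᵣ hx hy x<y apart
  values-not-apart-at-# hx hy (inj₂ y<x) apart = values-not-apart-at-<ᵣ hy hx y<x (#-sym apart)

theorem7 : (I : ℝ → Set) → IsInterval I →
           (f : (x : ℝ) → I x → ℝ) → IsConstructiveFunction I f →
           PotentiallyLocallyConstant I f →
           (x y : ℝ) (hx : I x) (hy : I y) → f x hx ≃ f y hy
theorem7 I isI f isFunction plc x y hx hy = ¬#⇒≃ values-not-apart
  where
  values-not-apart : ¬ f x hx # f y hy
  values-not-apart apart = #⇒≄ apart (isFunction x y hx hy
    (¬#⇒≃ λ x#y → values-not-apart-at-# isI plc hx hy x#y apart))
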